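{- For all formulas $A,B,C$ of $\mathcal{L}_{PAL}$, all lists of announcements $\alpha,\beta$, all DHSs $G$, dynamic sequents $X$ and finite multisets $M,N,M',N'$, the following dynamic hypersequents are derivable in $\mathbf{DHS}_{PAL}$: (1) $G \mid X /\!/_{\alpha\cdot A\cdot B\cdot\beta}\ C, M \Rightarrow N /\!/_{\alpha\cdot (A\wedge[A]B)\cdot\beta}\ M'\Rightarrow N', C$; (2) $G \mid X /\!/_{\alpha\cdot A\cdot B\cdot\beta}\ M \Rightarrow N, C /\!/_{\alpha\cdot (A\wedge[A]B)\cdot\beta}\ C, M'\Rightarrow N'$.
   Context: Formulas of $\mathcal{L}_{PAL}$ are generated by $A ::= p \mid \neg A \mid (A\wedge A) \mid \Box A \mid [A]A$ from a countable set of atoms. A list of announcements is a finite (possibly empty, $\epsilon$) sequence of formulas, $\alpha\cdot A$ its extension by $A$, $\alpha\cdot\beta$ concatenation. A sequent is $M\Rightarrow N$ ($M,N$ finite multisets); $A,\Gamma$ / $\Gamma,A$ add $A$ to antecedent / succedent. A dynamic sequent is $/\!/_{\alpha_1}\Gamma_1/\!/\cdots/\!/_{\alpha_n}\Gamma_n$ (components labelled by lists of announcements; $/\!/_\epsilon\Gamma$ written $\Gamma$); a DHS is $X_1\mid\cdots\mid X_n$ of dynamic sequents. $G\mid X/\!/_\alpha M\Rightarrow N$ denotes a DHS with a dynamic sequent having component labelled $\alpha$ equal to $M\Rightarrow N$, $X$ the rest of that dynamic sequent and $G$ the rest of the DHS (possibly empty); several components of one dynamic sequent are displayed similarly. Calculus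 $\mathbf{DHS}_{PAL}$ (notation "premises / conclusion"): Axioms $G\mid X/\!/_\alpha p,M\Rightarrow N,p$. (L$\neg$) $G\mid X/\!/_\alpha M\Rightarrow N,A$ / $G\mid X/\!/_\alpha\neg A,M\Rightarrow N$; (R$\neg$) $G\mid X/\!/_\alpha A,M\Rightarrow N$ / $G\mid X/\!/_\alpha M\Rightarrow N,\neg A$; (L$\wedge$) $G\mid X/\!/_\alpha A,B,M\Rightarrow N$ / $G\mid X/\!/_\alpha A\wedge B,M\Rightarrow N$; (R$\wedge$) $G\mid X/\!/_\alpha M\Rightarrow N,A$ and $G\mid X/\!/_\alpha M\Rightarrow N,B$ / $G\mid X/\!/_\alpha M\Rightarrow N,A\wedge B$; (L$\Box_1$) $G\mid X/\!/_\alpha\Box A,A,M\Rightarrow N$ / $G\mid X/\!/_\alpha\Box A,M\Rightarrow N$; (R$\Box$) $G\mid X/\!/_\alpha M\Rightarrow N\mid/\!/_\alpha\Rightarrow A$ / $G\mid X/\!/_\alpha M\Rightarrow N,\Box A$; (L$\Box_2$) $G\mid X/\!/_\alpha\Box A,M\Rightarrow N\mid Y/\!/_\alpha A,P\Rightarrow Q$ / $G\mid X/\!/_\alpha\Box A,M\Rightarrow N\mid Y/\!/_\alpha P\Rightarrow Q$; (L$\Box_3$) with $\beta=B_1\cdots B_n$, $\overline{Y}=Y/\!/_{\alpha\cdot\beta}\Box A,\Delta$: premises $G\mid X/\!/_\alpha\Gamma,B_1\mid\overline{Y}$, $G\mid X/\!/_\alpha\Gamma/\!/_{\alpha\cdot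 B_1\cdots B_i}\Rightarrow B_{i+1}\mid\overline{Y}$ ($1\le i<n$), $G\mid X/\!/_\alpha\Gamma/\!/_{\alpha\cdot\beta}A\Rightarrow\ \mid\overline{Y}$, conclusion $G\mid X/\!/_\alpha\Gamma\mid Y/\!/_{\alpha\cdot\beta}\Box A,\Delta$; (L$[\cdot]$) $G\mid X/\!/_\alpha M\Rightarrow N,A/\!/_{\alpha\cdot A}M'\Rightarrow N'$ and $G\mid X/\!/_\alpha M\Rightarrow N/\!/_{\alpha\cdot A}B,M'\Rightarrow N'$ / $G\mid X/\!/_\alpha[A]B,M\Rightarrow N/\!/_{\alpha\cdot A}M'\Rightarrow N'$; (R$[\cdot]$) $G\mid X/\!/_\alpha A,M\Rightarrow N/\!/_{\alpha\cdot A}M'\Rightarrow N',B$ / $G\mid X/\!/_\alpha M\Rightarrow N,[A]B/\!/_{\alpha\cdot A}M'\Rightarrow N'$ (in both, if no $\alpha\cdot A$ component is in the conclusion, the premises — for (L$[\cdot]$) the right one — contain a new component $/\!/_{\alpha\cdot A}$ with $M',N'$ empty); (Lat) $G\mid X/\!/_\alpha p,M\Rightarrow N/\!/_{\alpha\cdot A}p,M'\Rightarrow N'$ / $G\mid X/\!/_\alpha M\Rightarrow N/\!/_{\alpha\cdot A}p,M'\Rightarrow N'$; (Rat) $G\mid X/\!/_\alpha M\Rightarrow N,p/\!/_{\alpha\cdot A}M'\Rightarrow N',p$ / $G\mid X/\!/_\alpha M\Rightarrow N/\!/_{\alpha\cdot A}M'\Rightarrow N',p$; (New) $G\mid X/\!/_\alpha\Rightarrow\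 /\!/_{\alpha\cdot A}M\Rightarrow N$ / $G\mid X/\!/_{\alpha\cdot A}M\Rightarrow N$; (Recall) $G\mid X/\!/_\alpha A,M\Rightarrow N/\!/_{\alpha\cdot A}M'\Rightarrow N'$ / $G\mid X/\!/_\alpha M\Rightarrow N/\!/_{\alpha\cdot A}M'\Rightarrow N'$. -}

module Defs where

open import Data.Nat using (ℕ)
open import Data.List using (List; []; _∷_; _++_; [_]; _∷ʳ_)
open import Data.List.Membership.Propositional using (_∈_)
open import Data.List.Relation.Binary.Permutation.Propositional using (_↭_)
open import Data.List.Relation.Binary.Permutation.Homogeneous using (Permutation)
open import Data.Product using (_×_; _,_; proj₁)
open import Relation.Binary.PropositionalEquality using (_≡_; _≢_)
open import Relation.Nullary using (¬_)

infixr 6 _∧'_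
data Formula : Set where
  atom : ℕ → Formula
  ¬'_  : Formula → Formula
  _∧'_ : Formula → Formula → Formula
  □_   : Formula → Formula
  ⟦_⟧_ : Formula → Formula → Formula

-- Lists of announcements; α·A is  α ∷ʳ A,  α·β is  α ++ β
Ann : Set
Ann = List Formula

-- Sequents M ⇒ N (multisets represented by lists, taken up to permutation)
infix 4.5 _⇒_
record Sequent : Set where
  constructor _⇒_
  field
    ante : List Formula
    succ : List Formula
open Sequent public

Component : Set
Component = Ann × Sequent

DynSeq : Set
DynSeq = List Component

DHS : Set
DHS = List DynSeq

-- Equivalence "up to reordering" (multisets at every level)

SeqEq : Sequent → Sequent → Set
SeqEq s t = (ante s ↭ ante t) × (succ s ↭ succ t)

CompEq : Component → Component → Set
CompEq (α , s) (β , t) = (α ≡ β) × SeqEq s t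

DynEq : DynSeq → DynSeq → Set
DynEq = Permutation CompEq

DHSEq : DHS → DHS → Set
DHSEq = Permutation DynEq

NoLabel : Ann → DynSeq → Set
NoLabel α X = ¬ (α ∈ Data.List.map proj₁ X)
  where import Data.List

-- The calculus DHS_PAL.  Principal components are displayed at the
-- head of the lists; the rule `reorder` makes derivability invariant
-- under reordering (multiset reading of G, X, M, N).

data ⊢ : DHS → Set where
  reorder : ∀ {H H'} → ⊢ H → DHSEq H H' → ⊢ H'

  ax : ∀ {G X α p M N} →
    ⊢ (((α , atom p ∷ M ⇒ atom p ∷ N) ∷ X) ∷ G)

  L¬ : ∀ {G X α A M N} →
    ⊢ (((α , M ⇒ A ∷ N) ∷ X) ∷ G) →
    ⊢ (((α , ¬' A ∷ M ⇒ N) ∷ X) ∷ G)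

  R¬ : ∀ {G X α A M N} →
    ⊢ (((α , A ∷ M ⇒ N) ∷ X) ∷ G) →
    ⊢ (((α , M ⇒ ¬' A ∷ N) ∷ X) ∷ G)

  L∧ : ∀ {G X α A B M N} →
    ⊢ (((α , A ∷ B ∷ M ⇒ N) ∷ X) ∷ G) →
    ⊢ (((α , A ∧' B ∷ M ⇒ N) ∷ X) ∷ G)

  R∧ : ∀ {G X α A B M N} →
    ⊢ (((α , M ⇒ A ∷ N) ∷ X) ∷ G) →
    ⊢ (((α , M ⇒ B ∷ N) ∷ X) ∷ G) →
    ⊢ (((α , M ⇒ A ∧' B ∷ N) ∷ X) ∷ G)

  L□₁ : ∀ {G X α A M N} →
    ⊢ (((α , □ A ∷ A ∷ M ⇒ N) ∷ X) ∷ G) →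
    ⊢ (((α , □ A ∷ M ⇒ N) ∷ X) ∷ G)

  R□ : ∀ {G X α A M N} →
    ⊢ (((α , M ⇒ N) ∷ X) ∷ ((α , [] ⇒ [ A ]) ∷ []) ∷ G) →
    ⊢ (((α , M ⇒ □ A ∷ N) ∷ X) ∷ G)

  L□₂ : ∀ {G X Y α A M N P Q} →
    ⊢ (((α , □ A ∷ M ⇒ N) ∷ X) ∷ ((α , A ∷ P ⇒ Q) ∷ Y) ∷ G) →
    ⊢ (((α , □ A ∷ M ⇒ N) ∷ X) ∷ ((α , P ⇒ Q) ∷ Y) ∷ G)

  -- β = B₁ ⋯ Bₙ with n ≥ 1; Γ = M ⇒ N; Ȳ = Y //_{α·β} □A, Δ  (Δ = D ⇒ E)
  L□₃ : ∀ {G X Y α A B₁ Bs M N D E} →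
    ⊢ (((α , M ⇒ B₁ ∷ N) ∷ X) ∷ ((α ++ (B₁ ∷ Bs) , □ A ∷ D ⇒ E) ∷ Y) ∷ G) →
    (∀ β₁ C β₂ → B₁ ∷ Bs ≡ β₁ ++ C ∷ β₂ → β₁ ≢ [] →
      ⊢ (((α , M ⇒ N) ∷ (α ++ β₁ , [] ⇒ [ C ]) ∷ X)
           ∷ ((α ++ (B₁ ∷ Bs) , □ A ∷ D ⇒ E) ∷ Y) ∷ G)) →
    ⊢ (((α , M ⇒ N) ∷ (α ++ (B₁ ∷ Bs) , [ A ] ⇒ []) ∷ X)
         ∷ ((α ++ (B₁ ∷ Bs) , □ A ∷ D ⇒ E) ∷ Y) ∷ G) →
    ⊢ (((α , M ⇒ N) ∷ X) ∷ ((α ++ (B₁ ∷ Bs) , □ A ∷ D ⇒ E) ∷ Y) ∷ G)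

  L[] : ∀ {G X α A B M N M' N'} →
    ⊢ (((α , M ⇒ A ∷ N) ∷ (α ∷ʳ A , M' ⇒ N') ∷ X) ∷ G) →
    ⊢ (((α , M ⇒ N) ∷ (α ∷ʳ A , B ∷ M' ⇒ N') ∷ X) ∷ G) →
    ⊢ (((α , ⟦ A ⟧ B ∷ M ⇒ N) ∷ (α ∷ʳ A , M' ⇒ N') ∷ X) ∷ G)

  -- variant when the conclusion has no α·A component
  L[]new : ∀ {G X α A B M N} → NoLabel (α ∷ʳ A) X →
    ⊢ (((α , M ⇒ A ∷ N) ∷ X) ∷ G) →
    ⊢ (((α , M ⇒ N) ∷ (α ∷ʳ A , [ B ] ⇒ []) ∷ X) ∷ G) →
    ⊢ (((α , ⟦ A ⟧ B ∷ M ⇒ N) ∷ X) ∷ G)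

  R[] : ∀ {G X α A B M N M' N'} →
    ⊢ (((α , A ∷ M ⇒ N) ∷ (α ∷ʳ A , M' ⇒ B ∷ N') ∷ X) ∷ G) →
    ⊢ (((α , M ⇒ ⟦ A ⟧ B ∷ N) ∷ (α ∷ʳ A , M' ⇒ N') ∷ X) ∷ G)

  R[]new : ∀ {G X α A B M N} → NoLabel (α ∷ʳ A) X →
    ⊢ (((α , A ∷ M ⇒ N) ∷ (α ∷ʳ A , [] ⇒ [ B ]) ∷ X) ∷ G) →
    ⊢ (((α , M ⇒ ⟦ A ⟧ B ∷ N) ∷ X) ∷ G)

  Lat : ∀ {G X α A p M N M' N'} →
    ⊢ (((α , atom p ∷ M ⇒ N) ∷ (α ∷ʳ A , atom p ∷ M' ⇒ N') ∷ X) ∷ G) →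
    ⊢ (((α , M ⇒ N) ∷ (α ∷ʳ A , atom p ∷ M' ⇒ N') ∷ X) ∷ G)

  Rat : ∀ {G X α A p M N M' N'} →
    ⊢ (((α , M ⇒ atom p ∷ N) ∷ (α ∷ʳ A , M' ⇒ atom p ∷ N') ∷ X) ∷ G) →
    ⊢ (((α , M ⇒ N) ∷ (α ∷ʳ A , M' ⇒ atom p ∷ N') ∷ X) ∷ G)

  New : ∀ {G X α A M N} →
    ⊢ (((α , [] ⇒ []) ∷ (α ∷ʳ A , M ⇒ N) ∷ X) ∷ G) →
    ⊢ (((α ∷ʳ A , M ⇒ N) ∷ X) ∷ G)

  Recall : ∀ {G X α A M N M' N'} →
    ⊢ (((α , A ∷ M ⇒ N) ∷ (α ∷ʳ A , M' ⇒ N') ∷ X) ∷ G) →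
    ⊢ (((α , M ⇒ N) ∷ (α ∷ʳ A , M' ⇒ N') ∷ X) ∷ G)

-- By induction on the total size of C and β, C in a component labelled α·A·B·β and C in a
-- component labelled α·(A ∧ [A]B)·β entail each other.  Atoms move between parent and child
-- components (Lat, Rat, with New creating missing ancestors), so they can be carried up to α
-- and down again; ¬ and ∧ are local, and [D]E reduces to E at both labels extended by D.
-- For □C, R□ on one side opens a new dynamic sequent, New grows it into the chain of
-- components α, α·d₁, … and L□₃ answers the □C on the other side: its side premises for the
-- announcements of β are instances of the induction hypothesis, and those for A, B and
-- A ∧ [A]B follow from identities after Recall from the chain.

module Submission where

open import Data.Empty using (⊥-elim)
open import Data.List using (List; []; _∷_; _++_; [_]; _∷ʳ_; map; length)
open import Data.List.Properties
  using (≡-dec; ++-assoc; ++-identityʳ; ++-cancelˡ; ∷-injectiveˡ; ∷-injectiveʳ; ∷ʳ-injectiveˡ; map-++)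
open import Data.List.Relation.Unary.All using (All; []; _∷_)
open import Data.List.Relation.Unary.Any using (here; there)
open import Data.List.Relation.Binary.Permutation.Propositional
  using (_↭_; ↭-refl; ↭-prep; ↭-swap; ↭-trans; ↭-sym; ↭⇒↭ₛ)
open import Data.List.Relation.Binary.Permutation.Propositional.Properties using (shift; shifts; ++⁺ˡ)
import Data.List.Relation.Binary.Permutation.Homogeneous as Homogeneous
open import Data.Nat using (ℕ; suc; _+_; _<_; s≤s)
import Data.Nat as ℕ
open import Data.Nat.ListAction using (sum)
open import Data.Nat.ListAction.Properties using (sum-++)
open import Data.Nat.Induction using (<-wellFounded)
open import Data.Nat.Properties
  using (1+n≢n; m≢1+m+n; m≤m+n; m≤n+m; n<1+n; +-comm; +-monoʳ-≤; +-monoˡ-<; ≤-reflexive; module ≤-Reasoning)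
open import Data.Nat.Tactic.RingSolver using (solve-∀)
open import Data.Product using (_×_; _,_; ∃; ∃₂; proj₁; proj₂)
open import Data.Sum using (_⊎_; inj₁; inj₂)
open import Function using (_∘_)
open import Induction.WellFounded using (Acc; acc)
open import Relation.Binary.Definitions using (DecidableEquality)
open import Relation.Binary.PropositionalEquality using (_≡_; _≢_; refl; sym; trans; cong; subst; subst₂; ≢-sym)
open import Relation.Nullary using (yes; no)
open import Relation.Nullary.Decidable using (map′; _×-dec_)

open import Defs

variable
  p : ℕ
  C D E F : Formula
  γ δ : Ann
  M N M′ N′ : List Formula
  X Y : DynSeq
  G : DHS

∅ : Sequent
∅ = [] ⇒ []

swap-front : ∀ {a} {T : Set a} {x y : T} {R} → x ∷ y ∷ R ↭ y ∷ x ∷ R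
swap-front = ↭-swap _ _ ↭-refl

sink : ∀ {a} {T : Set a} {x : T} xs {R} → x ∷ xs ++ R ↭ xs ++ x ∷ R
sink xs = ↭-sym (shift _ xs _)

↭⇒DynEq : X ↭ Y → DynEq X Y
↭⇒DynEq = Homogeneous.map (λ { refl → refl , ↭-refl , ↭-refl }) ∘ ↭⇒↭ₛ

↭⇒DHSEq : ∀ {H H′} → H ↭ H′ → DHSEq H H′
↭⇒DHSEq = Homogeneous.map (λ { refl → ↭⇒DynEq ↭-refl }) ∘ ↭⇒↭ₛ

reorder-components : ⊢ (X ∷ G) → X ↭ Y → ⊢ (Y ∷ G)
reorder-components d X↭Y = reorder d (Homogeneous.prep (↭⇒DynEq X↭Y) (↭⇒DHSEq ↭-refl))

swap-dynamic : ⊢ (X ∷ Y ∷ G) → ⊢ (Y ∷ X ∷ G)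
swap-dynamic d = reorder d (↭⇒DHSEq swap-front)

exchangeˡ : ⊢ (((γ , C ∷ D ∷ M ⇒ N) ∷ X) ∷ G) → ⊢ (((γ , D ∷ C ∷ M ⇒ N) ∷ X) ∷ G)
exchangeˡ d = reorder d (Homogeneous.prep (Homogeneous.prep (refl , swap-front , ↭-refl) (↭⇒DynEq ↭-refl))
                                          (↭⇒DHSEq ↭-refl))

infix 4 _≟_
_≟_ : DecidableEquality Formula
atom m ≟ atom n = map′ (cong atom) (λ { refl → refl }) (m ℕ.≟ n)
¬' C ≟ ¬' D = map′ (cong ¬'_) (λ { refl → refl }) (C ≟ D)
(C ∧' D) ≟ (C′ ∧' D′) = map′ (λ { (refl , refl) → refl }) (λ { refl → refl , refl }) (C ≟ C′ ×-dec D ≟ D′)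
□ C ≟ □ D = map′ (cong □_) (λ { refl → refl }) (C ≟ D)
⟦ C ⟧ D ≟ ⟦ C′ ⟧ D′ = map′ (λ { (refl , refl) → refl }) (λ { refl → refl , refl }) (C ≟ C′ ×-dec D ≟ D′)
atom _ ≟ ¬' _ = no λ ()
atom _ ≟ (_ ∧' _) = no λ ()
atom _ ≟ □ _ = no λ ()
atom _ ≟ ⟦ _ ⟧ _ = no λ ()
¬' _ ≟ atom _ = no λ ()
¬' _ ≟ (_ ∧' _) = no λ ()
¬' _ ≟ □ _ = no λ ()
¬' _ ≟ ⟦ _ ⟧ _ = no λ ()
(_ ∧' _) ≟ atom _ = no λ ()
(_ ∧' _) ≟ ¬' _ = no λ ()
(_ ∧' _) ≟ □ _ = no λ ()
(_ ∧' _) ≟ ⟦ _ ⟧ _ = no λ ()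
□ _ ≟ atom _ = no λ ()
□ _ ≟ ¬' _ = no λ ()
□ _ ≟ (_ ∧' _) = no λ ()
□ _ ≟ ⟦ _ ⟧ _ = no λ ()
⟦ _ ⟧ _ ≟ atom _ = no λ ()
⟦ _ ⟧ _ ≟ ¬' _ = no λ ()
⟦ _ ⟧ _ ≟ (_ ∧' _) = no λ ()
⟦ _ ⟧ _ ≟ □ _ = no λ ()

Labelled : Ann → DynSeq → Set
Labelled l X = ∃₂ λ s R → X ↭ (l , s) ∷ R

labelled-∷ : ∀ {l c} → Labelled l X → Labelled l (c ∷ X)
labelled-∷ {c = c} (s , R , X↭) = s , c ∷ R , ↭-trans (↭-prep c X↭) swap-front

labelled-++ : ∀ {l} Y → Labelled l X → Labelled l (Y ++ X)
labelled-++ Y (s , R , X↭) = s , Y ++ R , ↭-trans (++⁺ˡ Y X↭) (shift _ Y R)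

label? : ∀ l X → NoLabel l X ⊎ Labelled l X
label? l [] = inj₁ λ ()
label? l ((l′ , s) ∷ X) with ≡-dec _≟_ l l′ | label? l X
... | yes refl | _ = inj₂ (s , X , ↭-refl)
... | no l≢l′ | inj₁ fresh = inj₁ λ { (here eq) → l≢l′ eq ; (there l∈X) → fresh l∈X }
... | no _ | inj₂ labelled = inj₂ (labelled-∷ labelled)

fresh-++ : ∀ {l} Y → All (l ≢_) (map proj₁ Y) → NoLabel l X → NoLabel l (Y ++ X)
fresh-++ [] [] fresh = fresh
fresh-++ (_ ∷ _) (l≢ ∷ _) _ (here eq) = l≢ eq
fresh-++ (_ ∷ Y) (_ ∷ Y-fresh) fresh (there l∈) = fresh-++ Y Y-fresh fresh l∈

-- Whether Y ++ X already has a component labelled γ·D is decided inside, so the premises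
-- quantify over every possible such component.
R[]′ : ∀ Y X → All ((γ ∷ʳ D) ≢_) (map proj₁ Y) →
  (∀ {P Q R} → ⊢ (((γ , D ∷ M ⇒ N) ∷ (γ ∷ʳ D , P ⇒ E ∷ Q) ∷ Y ++ R) ∷ G)) →
  ⊢ (((γ , M ⇒ ⟦ D ⟧ E ∷ N) ∷ Y ++ X) ∷ G)
R[]′ {γ = γ} {D = D} Y X Y-fresh premise with label? (γ ∷ʳ D) X
... | inj₁ fresh = R[]new (fresh-++ Y Y-fresh fresh) premise
... | inj₂ labelled = reorder-components (R[] premise) (↭-prep _ (↭-sym (proj₂ (proj₂ (labelled-++ Y labelled)))))

L[]′ : ∀ Y X → All ((γ ∷ʳ D) ≢_) (map proj₁ Y) →
  (∀ {R} → ⊢ (((γ , M ⇒ D ∷ N) ∷ Y ++ R) ∷ G)) →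
  (∀ {P Q R} → ⊢ (((γ , M ⇒ N) ∷ (γ ∷ʳ D , E ∷ P ⇒ Q) ∷ Y ++ R) ∷ G)) →
  ⊢ (((γ , ⟦ D ⟧ E ∷ M ⇒ N) ∷ Y ++ X) ∷ G)
L[]′ {γ = γ} {D = D} Y X Y-fresh left right with label? (γ ∷ʳ D) X
... | inj₁ fresh = L[]new (fresh-++ Y Y-fresh fresh) left right
... | inj₂ labelled =
  let YX↭ = proj₂ (proj₂ (labelled-++ Y labelled))
  in reorder-components (L[] (reorder-components left (↭-prep _ YX↭)) right) (↭-prep _ (↭-sym YX↭))

recall : Labelled (γ ∷ʳ F) X → ⊢ (((γ , F ∷ M ⇒ N) ∷ X) ∷ G) → ⊢ (((γ , M ⇒ N) ∷ X) ∷ G)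
recall (_ , _ , X↭) d = reorder-components (Recall (reorder-components d (↭-prep _ X↭))) (↭-prep _ (↭-sym X↭))

identity : ∀ C → ⊢ (((γ , C ∷ M ⇒ C ∷ N) ∷ X) ∷ G)
identity (atom p) = ax
identity (¬' C) = R¬ (exchangeˡ (L¬ (identity C)))
identity (C ∧' D) = R∧ (L∧ (identity C)) (L∧ (exchangeˡ (identity D)))
identity (□ C) = R□ (L□₂ (swap-dynamic (identity C)))
identity {X = X} (⟦ D ⟧ E) =
  R[]′ [] X [] (exchangeˡ (L[] (identity D) (reorder-components (identity E) swap-front)))

spine : Ann → List Formula → Sequent → DynSeq
spine γ [] s = (γ , s) ∷ []
spine γ (d ∷ δ) s = (γ , ∅) ∷ spine (γ ∷ʳ d) δ s

new-spine : ∀ δ {s} → ⊢ (spine γ δ s ∷ G) → ⊢ (((γ ++ δ , s) ∷ []) ∷ G)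
new-spine {γ = γ} {G = G} [] {s} d = subst (λ l → ⊢ (((l , s) ∷ []) ∷ G)) (sym (++-identityʳ γ)) d
new-spine (_ ∷ []) d = New d
new-spine {γ = γ} {G = G} (e ∷ f ∷ δ) {s} d =
  subst (λ l → ⊢ (((l , s) ∷ []) ∷ G)) (++-assoc γ [ e ] (f ∷ δ)) (new-spine (f ∷ δ) (New d))

spine-head : ∀ γ δ s → Labelled γ (spine γ δ s)
spine-head γ [] s = s , [] , ↭-refl
spine-head γ (_ ∷ _) s = ∅ , _ , ↭-refl

spine-last : ∀ γ δ s → ∃ λ R → spine γ δ s ↭ (γ ++ δ , s) ∷ R
spine-last γ [] s rewrite ++-identityʳ γ = [] , ↭-refl
spine-last γ (d ∷ δ) s with spine-last (γ ∷ʳ d) δ s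
... | R , ↭last rewrite ++-assoc γ [ d ] δ = (γ , ∅) ∷ R , ↭-trans (↭-prep _ ↭last) swap-front

spine-parent : ∀ γ δ₁ E δ₂ s →
  ∃₂ λ t R → spine γ (δ₁ ++ E ∷ δ₂) s ↭ (γ ++ δ₁ , ∅) ∷ ((γ ++ δ₁) ∷ʳ E , t) ∷ R
spine-parent γ [] E δ₂ s rewrite ++-identityʳ γ =
  let (t , R , ↭head) = spine-head (γ ∷ʳ E) δ₂ s in t , R , ↭-prep _ ↭head
spine-parent γ (d ∷ δ₁) E δ₂ s with spine-parent (γ ∷ʳ d) δ₁ E δ₂ s
... | t , R , ↭parent rewrite ++-assoc γ [ d ] δ₁ =
  t , (γ , ∅) ∷ R , ↭-trans (↭-prep _ ↭parent) (sink (_ ∷ _ ∷ []))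

spine-recall : ∀ Y γ δ₁ E δ₂ s →
  (∀ {R} → ⊢ (((γ ++ δ₁ , [ E ] ⇒ []) ∷ Y ++ R) ∷ G)) →
  ⊢ ((Y ++ spine γ (δ₁ ++ E ∷ δ₂) s) ∷ G)
spine-recall Y γ δ₁ E δ₂ s premise with spine-parent γ δ₁ E δ₂ s
... | _ , _ , ↭parent =
  reorder-components (Recall (reorder-components premise (↭-prep _ (shift _ Y _))))
                     (↭-sym (↭-trans (++⁺ˡ Y ↭parent) (shifts Y (_ ∷ _ ∷ []))))

-- C true at the component labelled γ forces C true at the one labelled δ.
Entails : Formula → Ann → Ann → Set
Entails C γ δ = ∀ {M N M′ N′ X G} → ⊢ (((γ , C ∷ M ⇒ N) ∷ (δ , M′ ⇒ C ∷ N′) ∷ X) ∷ G)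

Equivalent : Formula → Ann → Ann → Set
Equivalent C γ δ = Entails C γ δ × Entails C δ γ

atom-parent : ∀ d → Entails (atom p) (γ ∷ʳ d) γ
atom-parent _ = reorder-components (Lat ax) swap-front

atom-child : ∀ d → Entails (atom p) γ (γ ∷ʳ d)
atom-child _ = Rat ax

atom-climbˡ : ∀ d → Entails (atom p) γ δ → Entails (atom p) (γ ∷ʳ d) δ
atom-climbˡ _ h = New (Lat (reorder-components h (↭-prep _ swap-front)))

atom-climbʳ : ∀ d → Entails (atom p) γ δ → Entails (atom p) γ (δ ∷ʳ d)
atom-climbʳ _ h = reorder-components (New (Rat (reorder-components h (sink (_ ∷ _ ∷ []))))) swap-front

atom-descendˡ : ∀ γ d ε → Entails (atom p) (γ ∷ʳ d) δ → Entails (atom p) (γ ++ d ∷ ε) δ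
atom-descendˡ _ _ [] h = h
atom-descendˡ γ d (e ∷ ε) h =
  subst (λ l → Entails _ l _) (++-assoc γ [ d ] (e ∷ ε)) (atom-descendˡ (γ ∷ʳ d) e ε (atom-climbˡ e h))

atom-descendʳ : ∀ δ d ε → Entails (atom p) γ (δ ∷ʳ d) → Entails (atom p) γ (δ ++ d ∷ ε)
atom-descendʳ _ _ [] h = h
atom-descendʳ δ d (e ∷ ε) h =
  subst (Entails _ _) (++-assoc δ [ d ] (e ∷ ε)) (atom-descendʳ (δ ∷ʳ d) e ε (atom-climbʳ e h))

¬-equivalent : Equivalent C γ δ → Equivalent (¬' C) γ δ
¬-equivalent (h , h′) = L¬ (reorder-components (R¬ h′) swap-front) , L¬ (reorder-components (R¬ h) swap-front)

∧-entails : Entails C γ δ → Entails D γ δ → Entails (C ∧' D) γ δ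
∧-entails hC hD =
  L∧ (reorder-components (R∧ (reorder-components hC swap-front) (reorder-components (exchangeˡ hD) swap-front))
                         swap-front)

∧-equivalent : Equivalent C γ δ → Equivalent D γ δ → Equivalent (C ∧' D) γ δ
∧-equivalent (hC , hC′) (hD , hD′) = ∧-entails hC hD , ∧-entails hC′ hD′

⟦⟧-entails : γ ∷ʳ D ≢ δ → δ ∷ʳ D ≢ γ → γ ≢ δ →
  Entails D δ γ → Entails E (γ ∷ʳ D) (δ ∷ʳ D) → Entails (⟦ D ⟧ E) γ δ
⟦⟧-entails {γ} {D} {δ} {E} γD≢δ δD≢γ γ≢δ hD hE {M} {N} {M′} {N′} {X} =
  L[]′ ((δ , M′ ⇒ ⟦ D ⟧ E ∷ N′) ∷ []) X (γD≢δ ∷ [])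
    (reorder-components
      (R[]′ ((γ , M ⇒ D ∷ N) ∷ []) _ (δD≢γ ∷ []) (reorder-components hD (↭-prep _ swap-front)))
      swap-front)
    (λ {P} {Q} → reorder-components
      (R[]′ ((γ , M ⇒ N) ∷ (γ ∷ʳ D , E ∷ P ⇒ Q) ∷ []) _ (δD≢γ ∷ δD≢γD ∷ [])
        (reorder-components hE (↭-trans (sink (_ ∷ _ ∷ _ ∷ [])) swap-front)))
      (sink (_ ∷ _ ∷ [])))
  where
  δD≢γD : δ ∷ʳ D ≢ γ ∷ʳ D
  δD≢γD eq = γ≢δ (sym (∷ʳ-injectiveˡ δ γ eq))

⟦⟧-equivalent : γ ∷ʳ D ≢ δ → δ ∷ʳ D ≢ γ → γ ≢ δ →
  Equivalent D γ δ → Equivalent E (γ ∷ʳ D) (δ ∷ʳ D) → Equivalent (⟦ D ⟧ E) γ δ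
⟦⟧-equivalent γD≢δ δD≢γ γ≢δ (hD , hD′) (hE , hE′) =
  ⟦⟧-entails γD≢δ δD≢γ γ≢δ hD′ hE , ⟦⟧-entails δD≢γ γD≢δ (≢-sym γ≢δ) hD hE′

∷-++-≢ : ∀ {a} {T : Set a} {x : T} (xs ys : List T) → x ∷ xs ++ ys ≢ xs
∷-++-≢ [] _ ()
∷-++-≢ (_ ∷ xs) ys eq = ∷-++-≢ xs ys (∷-injectiveʳ eq)

size : Formula → ℕ
size (atom _) = 1
size (¬' C) = suc (size C)
size (C ∧' D) = suc (size C + size D)
size (□ C) = suc (size C)
size (⟦ C ⟧ D) = suc (size C + size D)

sizes : List Formula → ℕ
sizes = sum ∘ map size

sizes-++ : ∀ β β′ → sizes (β ++ β′) ≡ sizes β + sizes β′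
sizes-++ β β′ = trans (cong sum (map-++ size β β′)) (sum-++ (map size β) (map size β′))

announcement-smaller : ∀ C β₁ E β₂ → size E + sizes β₁ < size (□ C) + sizes (β₁ ++ E ∷ β₂)
announcement-smaller C β₁ E β₂ = s≤s (begin
  size E + sizes β₁                ≡⟨ +-comm (size E) (sizes β₁) ⟩
  sizes β₁ + size E                ≤⟨ +-monoʳ-≤ (sizes β₁) (m≤m+n (size E) (sizes β₂)) ⟩
  sizes β₁ + (size E + sizes β₂)   ≡⟨ sym (sizes-++ β₁ (E ∷ β₂)) ⟩
  sizes (β₁ ++ E ∷ β₂)             ≤⟨ m≤n+m _ (size C) ⟩
  size C + sizes (β₁ ++ E ∷ β₂)    ∎)
  where open ≤-Reasoning

body-smaller : ∀ D E β → size E + sizes (β ∷ʳ D) < size (⟦ D ⟧ E) + sizes β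
body-smaller D E β = s≤s (≤-reflexive (trans (cong (size E +_) (sizes-++ β [ D ]))
                                             (rearrange (size D) (size E) (sizes β))))
  where
  rearrange : ∀ d e b → e + (b + (d + 0)) ≡ d + e + b
  rearrange = solve-∀

□-via-spine : ∀ α d δ B₁ Bs {C} →
  (∀ {Y G} → ⊢ (((α , [] ⇒ [ B₁ ]) ∷ spine (α ∷ʳ d) δ ([] ⇒ [ C ])) ∷ Y ∷ G)) →
  (∀ {Y G} β₁ E β₂ → B₁ ∷ Bs ≡ β₁ ++ E ∷ β₂ → β₁ ≢ [] →
     ⊢ (((α , ∅) ∷ (α ++ β₁ , [] ⇒ [ E ]) ∷ spine (α ∷ʳ d) δ ([] ⇒ [ C ])) ∷ Y ∷ G)) →
  Entails C (α ++ B₁ ∷ Bs) (α ++ d ∷ δ) →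
  Entails (□ C) (α ++ B₁ ∷ Bs) (α ++ d ∷ δ)
□-via-spine α d δ B₁ Bs {C} first middle hC =
  reorder-components (R□ (reorder-components (swap-dynamic (new-spine (d ∷ δ) (L□₃ first middle last))) swap-front))
                     swap-front
  where
  last : ∀ {Y G} → ⊢ (((α , ∅) ∷ (α ++ B₁ ∷ Bs , [ C ] ⇒ []) ∷ spine (α ∷ʳ d) δ ([] ⇒ [ C ])) ∷ Y ∷ G)
  last = let (_ , ↭last) = spine-last α (d ∷ δ) ([] ⇒ [ C ]) in
         reorder-components hC (↭-trans (↭-prep _ (↭-sym ↭last)) swap-front)

module Composition (α : Ann) (A B : Formula) where

  composite : Formula
  composite = A ∧' ⟦ A ⟧ B

  stepwise : Ann → Ann
  stepwise β = α ++ A ∷ B ∷ β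

  composed : Ann → Ann
  composed β = α ++ composite ∷ β

  EquivalentAnnouncements : Ann → Set
  EquivalentAnnouncements β =
    ∀ {β₁ E β₂} → β ≡ β₁ ++ E ∷ β₂ → Equivalent E (stepwise β₁) (composed β₁)

  stepwise-∷ʳ : ∀ β D → stepwise β ∷ʳ D ≡ stepwise (β ∷ʳ D)
  stepwise-∷ʳ β D = ++-assoc α (A ∷ B ∷ β) [ D ]

  composed-∷ʳ : ∀ β D → composed β ∷ʳ D ≡ composed (β ∷ʳ D)
  composed-∷ʳ β D = ++-assoc α (composite ∷ β) [ D ]

  stepwise≢composed : ∀ β → stepwise β ≢ composed β
  stepwise≢composed β eq = 1+n≢n (cong length (∷-injectiveʳ (++-cancelˡ α _ _ eq)))

  stepwise∷ʳ≢composed : ∀ β D → stepwise β ∷ʳ D ≢ composed β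
  stepwise∷ʳ≢composed β D eq =
    ∷-++-≢ β [ D ] (∷-injectiveʳ (++-cancelˡ α _ _ (trans (sym (stepwise-∷ʳ β D)) eq)))

  composed∷ʳ≢stepwise : ∀ β D → composed β ∷ʳ D ≢ stepwise β
  composed∷ʳ≢stepwise β D eq =
    m≢1+m+n (size A) (sym (cong size (∷-injectiveˡ (++-cancelˡ α _ _ (trans (sym (composed-∷ʳ β D)) eq)))))

  atom-equivalent : ∀ β → Equivalent (atom p) (stepwise β) (composed β)
  atom-equivalent β =
    atom-descendʳ α composite β (atom-climbʳ composite (atom-descendˡ α A (B ∷ β) (atom-parent A))) ,
    atom-descendˡ α composite β (atom-climbˡ composite (atom-descendʳ α A (B ∷ β) (atom-child A)))

  stepwise-middle : ∀ {β s Y G} → EquivalentAnnouncements β →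
    ∀ β₁ E β₂ → A ∷ B ∷ β ≡ β₁ ++ E ∷ β₂ → β₁ ≢ [] →
    ⊢ (((α , ∅) ∷ (α ++ β₁ , [] ⇒ [ E ]) ∷ spine (α ∷ʳ composite) β s) ∷ Y ∷ G)
  stepwise-middle _ [] _ _ _ β₁≢[] = ⊥-elim (β₁≢[] refl)
  stepwise-middle {β} {s} _ (_ ∷ []) _ _ refl _ =
    recall (labelled-∷ (spine-head (α ∷ʳ composite) β s))
      (L∧ (exchangeˡ (L[] (identity A) (reorder-components (identity B) swap-front))))
  stepwise-middle {s = s} announcements (_ ∷ _ ∷ β₁) E β₂ refl _ =
    reorder-components
      (spine-recall ((stepwise β₁ , [] ⇒ [ E ]) ∷ []) α (composite ∷ β₁) E β₂ s (proj₂ (announcements refl)))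
      swap-front

  composed-middle : ∀ {β s Y G} → EquivalentAnnouncements β →
    ∀ β₁ E β₂ → composite ∷ β ≡ β₁ ++ E ∷ β₂ → β₁ ≢ [] →
    ⊢ (((α , ∅) ∷ (α ++ β₁ , [] ⇒ [ E ]) ∷ (α ∷ʳ A , ∅) ∷ spine (α ∷ʳ A ∷ʳ B) β s) ∷ Y ∷ G)
  composed-middle _ [] _ _ _ β₁≢[] = ⊥-elim (β₁≢[] refl)
  composed-middle {s = s} announcements (_ ∷ β₁) E β₂ refl _ =
    reorder-components
      (spine-recall ((composed β₁ , [] ⇒ [ E ]) ∷ []) α (A ∷ B ∷ β₁) E β₂ s (proj₁ (announcements refl)))
      swap-front

  stepwise-first : ∀ {β s Y G} → ⊢ (((α , [] ⇒ [ A ]) ∷ spine (α ∷ʳ composite) β s) ∷ Y ∷ G)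
  stepwise-first {β} {s} = recall (spine-head _ β s) (L∧ (identity A))

  composed-first : ∀ {β s Y G} → ⊢ (((α , [] ⇒ [ composite ]) ∷ spine (α ∷ʳ A) (B ∷ β) s) ∷ Y ∷ G)
  composed-first {β} {s} =
    R∧ (Recall (identity A)) (R[] (reorder-components (recall (labelled-∷ (spine-head _ β s)) (identity B)) swap-front))

  □-equivalent : ∀ {β} → EquivalentAnnouncements β →
    Equivalent C (stepwise β) (composed β) → Equivalent (□ C) (stepwise β) (composed β)
  □-equivalent {β = β} announcements (h , h′) =
    □-via-spine α composite β A (B ∷ β) stepwise-first (stepwise-middle announcements) h ,
    □-via-spine α A (B ∷ β) composite β composed-first (composed-middle announcements) h′

  equivalent : ∀ C β → Acc _<_ (size C + sizes β) → Equivalent C (stepwise β) (composed β)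
  equivalent (atom p) β _ = atom-equivalent β
  equivalent (¬' C) β (acc smaller) = ¬-equivalent (equivalent C β (smaller (n<1+n _)))
  equivalent (C ∧' D) β (acc smaller) =
    ∧-equivalent (equivalent C β (smaller (+-monoˡ-< (sizes β) (s≤s (m≤m+n (size C) (size D))))))
                 (equivalent D β (smaller (+-monoˡ-< (sizes β) (s≤s (m≤n+m (size D) (size C))))))
  equivalent (□ C) β (acc smaller) =
    □-equivalent (λ { {β₁} {E} {β₂} refl → equivalent E β₁ (smaller (announcement-smaller C β₁ E β₂)) })
                 (equivalent C β (smaller (n<1+n _)))
  equivalent (⟦ D ⟧ E) β (acc smaller) =
    ⟦⟧-equivalent (stepwise∷ʳ≢composed β D) (composed∷ʳ≢stepwise β D) (stepwise≢composed β)
      (equivalent D β (smaller (+-monoˡ-< (sizes β) (s≤s (m≤m+n (size D) (size E))))))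
      (subst₂ (Equivalent E) (sym (stepwise-∷ʳ β D)) (sym (composed-∷ʳ β D))
        (equivalent E (β ∷ʳ D) (smaller (body-smaller D E β))))

mainTheorem12 : (A B C : Formula) (α β : Ann) (G : DHS) (X : DynSeq)
    (M N M' N' : List Formula) →
    ⊢ (((α ++ A ∷ B ∷ β , C ∷ M ⇒ N)
    ∷ (α ++ (A ∧' ⟦ A ⟧ B) ∷ β , M' ⇒ C ∷ N') ∷ X) ∷ G)
    × ⊢ (((α ++ A ∷ B ∷ β , M ⇒ C ∷ N)
    ∷ (α ++ (A ∧' ⟦ A ⟧ B) ∷ β , C ∷ M' ⇒ N') ∷ X) ∷ G)
mainTheorem12 A B C α β G X M N M' N' =
  let (forward , backward) = Composition.equivalent α A B C β (<-wellFounded _)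
  in forward , reorder-components backward swap-front
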